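{- For any points $t_1,\dots,t_m\in\mathbb{R}^d$, there is an $md$-variate real polynomial $f$ such that for all $p_1,\dots,p_m\in\mathbb{R}^d$, we have $f(p_1,\dots,p_m)=0$ if and only if $(p_1,\dots,p_m)\propto(t_1,\dots,t_m)$.
   Context: For $m$-tuples $(p_1,\dots,p_m)$ and $(t_1,\dots,t_m)$ of points in $\mathbb{R}^d$, write $(p_1,\dots,p_m)\propto(t_1,\dots,t_m)$ if there exist $p^*\in\mathbb{R}^d$ and $\lambda\in\mathbb{R}$ (possibly negative or zero) such that $p_i=p^*+\lambda t_i$ for every $i\in[m]$. -}

module Defs where

open import Level using (0ℓ)
open import Data.Fin using (Fin)
open import Data.Sum using (_⊎_)
open import Data.Product using (Σ; ∃; ∃-syntax; _×_; _,_)
open import Relation.Nullary using (¬_)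
open import Relation.Binary.PropositionalEquality using (_≡_)
open import Relation.Binary.Structures using (IsStrictTotalOrder)
open import Algebra.Structures using (IsCommutativeRing)

-- An axiomatization of the real numbers: a complete ordered field
-- (Dedekind-complete: every nonempty bounded-above set has a supremum).
record RealField : Set₁ where
  infixl 6 _+_
  infixl 7 _*_
  infix  4 _<_
  field
    Carrier : Set
    _+_ _*_ : Carrier → Carrier → Carrier
    -_      : Carrier → Carrier
    0# 1#   : Carrier
    isCommutativeRing : IsCommutativeRing _≡_ _+_ _*_ -_ 0# 1#
    0≢1     : ¬ (0# ≡ 1#)
    _⁻¹     : (x : Carrier) → ¬ (x ≡ 0#) → Carrier
    ⁻¹-inverse : (x : Carrier) (nz : ¬ (x ≡ 0#)) → x * (x ⁻¹) nz ≡ 1#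
    _<_     : Carrier → Carrier → Set
    isStrictTotalOrder : IsStrictTotalOrder _≡_ _<_
    +-mono-< : ∀ {x y} z → x < y → x + z < y + z
    *-pos    : ∀ {x y} → 0# < x → 0# < y → 0# < x * y

    completeness : (S : Carrier → Set) → (∃[ x ] S x) →
                   (∃[ b ] (∀ x → S x → (x < b ⊎ x ≡ b))) →
                   ∃[ s ] ((∀ x → S x → (x < s ⊎ x ≡ s)) ×
                           (∀ b → (∀ x → S x → (x < b ⊎ x ≡ b)) → (s < b ⊎ s ≡ b)))

-- Multivariate polynomials with coefficients in A and variables indexed by V
-- (formal expressions; every polynomial is denoted by such an expression).
data Poly (A : Set) (V : Set) : Set where
  const : A → Poly A V
  var   : V → Poly A V
  _⊕_   : Poly A V → Poly A V → Poly A V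
  _⊗_   : Poly A V → Poly A V → Poly A V

module _ (ℝ : RealField) where
  open RealField ℝ

  eval : {V : Set} → Poly Carrier V → (V → Carrier) → Carrier
  eval (const a) x = a
  eval (var v)   x = x v
  eval (f ⊕ g)   x = eval f x + eval g x
  eval (f ⊗ g)   x = eval f x * eval g x

  _∝_ : {m d : _} → (Fin m → Fin d → Carrier) → (Fin m → Fin d → Carrier) → Set
  _∝_ {m} {d} p t = Σ (Fin d → Carrier) λ p* → Σ Carrier λ l →
                    ∀ (i : Fin m) (k : Fin d) → p i k ≡ p* k + l * t i k

-- Writing s = (p_i − p_1)_i and u = (t_i − t_1)_i, we have p ∝ t exactly when s is a scalar
-- multiple of the fixed vector u. That is a system of polynomial equations in p: if u = 0 it
-- says s = 0, and if some entry u_j is nonzero it says u_j s_n = s_j u_n for every n. Over an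
-- ordered field a system g_n = 0 is equivalent to the single equation Σ g_n² = 0.
module Submission where

open import Defs
open import Level using (Level; 0ℓ)
open import Data.Nat using (ℕ; zero; suc)
open import Data.Fin using (Fin; zero; suc)
open import Data.Fin.Properties using (all?; ¬∀⟶∃¬)
open import Data.Product using (Σ; ∃; _×_; _,_; proj₁; proj₂; uncurry)
open import Data.Sum using (_⊎_; inj₁; inj₂)
open import Data.Vec.Functional using (Vector; foldr)
open import Relation.Nullary using (¬_; yes; no; contradiction)
open import Relation.Binary.PropositionalEquality
  using (_≡_; _≢_; refl; sym; trans; cong; cong₂; subst; subst₂; module ≡-Reasoning)
open import Relation.Binary.Structures using (IsStrictTotalOrder)
open import Relation.Binary.Definitions using (tri<; tri≈; tri>)
open import Algebra.Bundles using (CommutativeRing)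
open import Function.Bundles using (_⇔_; mk⇔; Equivalence)
open import Function.Related.Propositional using (≡⇒; equivalence; module EquationalReasoning)
open import Function.Base using (_∘_)
import Function.Properties.Equivalence as ⇔
import Algebra.Properties.Ring as RingProperties
import Algebra.Properties.CommutativeSemigroup as CommutativeSemigroupProperties
import Algebra.Properties.Monoid.Sum as MonoidSum
import Relation.Binary.Construct.StrictToNonStrict as StrictToNonStrict

private
  variable
    a ℓ₁ ℓ₂ : Level
    A : Set a
    U V W : Set

∀-cong-⇔ : {P : A → Set ℓ₁} {Q : A → Set ℓ₂} →
           (∀ x → P x ⇔ Q x) → (∀ x → P x) ⇔ (∀ x → Q x)
∀-cong-⇔ P⇔Q = mk⇔ (λ ∀P x → Equivalence.to (P⇔Q x) (∀P x))
                   (λ ∀Q x → Equivalence.from (P⇔Q x) (∀Q x))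

∀-curry-⇔ : ∀ {m d} {P : Fin m × Fin d → Set ℓ₁} → (∀ i k → P (i , k)) ⇔ (∀ n → P n)
∀-curry-⇔ = mk⇔ (λ ∀P (i , k) → ∀P i k) (λ ∀P i k → ∀P (i , k))

infixl 25 _[_]
_[_] : Poly U V → (V → Poly U W) → Poly U W
const c [ σ ] = const c
var v   [ σ ] = σ v
(f ⊕ g) [ σ ] = f [ σ ] ⊕ g [ σ ]
(f ⊗ g) [ σ ] = f [ σ ] ⊗ g [ σ ]

module RealFieldProperties (ℝ : RealField) where
  open RealField ℝ using (Carrier; _⁻¹; ⁻¹-inverse; _<_; isStrictTotalOrder; +-mono-<; *-pos)

  commutativeRing : CommutativeRing 0ℓ 0ℓ
  commutativeRing = record { isCommutativeRing = RealField.isCommutativeRing ℝ }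

  open CommutativeRing commutativeRing
    using (_+_; _*_; -_; _-_; 0#; 1#; ring; +-monoid;
           +-commutativeSemigroup; *-commutativeSemigroup;
           +-comm; +-identityˡ; +-identityʳ; -‿inverseʳ; *-assoc; *-comm; *-identityˡ; zeroˡ; zeroʳ)
  open RingProperties ring
    using (-1*x≈-x; -‿distribˡ-*; -‿distribʳ-*; -‿involutive; -‿+-comm;
           x[y-z]≈xy-xz; x∙y⁻¹≈ε⇒x≈y; x≈y⇒x∙y⁻¹≈ε)
  open CommutativeSemigroupProperties +-commutativeSemigroup using (interchange; x∙yz≈xz∙y)
  open CommutativeSemigroupProperties *-commutativeSemigroup using (x∙yz≈yx∙z)
  open MonoidSum +-monoid using (sum; sum-cong-≗; sum-syntax)
  open IsStrictTotalOrder isStrictTotalOrder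
    using (_≟_; compare; irrefl) renaming (trans to <-trans)
  open StrictToNonStrict _≡_ _<_ using (_≤_)
  open ≡-Reasoning

  x-y≡0⇔x≡y : ∀ {x y} → x - y ≡ 0# ⇔ x ≡ y
  x-y≡0⇔x≡y {x} {y} = mk⇔ (x∙y⁻¹≈ε⇒x≈y x y) x≈y⇒x∙y⁻¹≈ε

  [x+y]-[x+z]≡y-z : ∀ x y z → (x + y) - (x + z) ≡ y - z
  [x+y]-[x+z]≡y-z x y z = begin
    (x + y) - (x + z)       ≡⟨ cong ((x + y) +_) (sym (-‿+-comm x z)) ⟩
    (x + y) + (- x + - z)   ≡⟨ interchange x y (- x) (- z) ⟩
    (x + - x) + (y - z)     ≡⟨ cong (_+ (y - z)) (-‿inverseʳ x) ⟩
    0# + (y - z)            ≡⟨ +-identityˡ (y - z) ⟩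
    y - z                   ∎

  x+[y-x]≡y : ∀ x y → x + (y - x) ≡ y
  x+[y-x]≡y x y = begin
    x + (y - x)     ≡⟨ x∙yz≈xz∙y x y (- x) ⟩
    (x - x) + y     ≡⟨ cong (_+ y) (-‿inverseʳ x) ⟩
    0# + y          ≡⟨ +-identityˡ y ⟩
    y               ∎

  -x*-x≡x*x : ∀ x → - x * - x ≡ x * x
  -x*-x≡x*x x = begin
    - x * - x       ≡⟨ sym (-‿distribˡ-* x (- x)) ⟩
    - (x * - x)     ≡⟨ cong -_ (sym (-‿distribʳ-* x x)) ⟩
    - - (x * x)     ≡⟨ -‿involutive (x * x) ⟩
    x * x           ∎

  x<0⇒0<-x : ∀ {x} → x < 0# → 0# < - x
  x<0⇒0<-x {x} x<0 = subst₂ _<_ (-‿inverseʳ x) (+-identityˡ (- x)) (+-mono-< (- x) x<0)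

  x≢0⇒0<x*x : ∀ {x} → x ≢ 0# → 0# < x * x
  x≢0⇒0<x*x {x} x≢0 with compare 0# x
  ... | tri< 0<x _ _ = *-pos 0<x 0<x
  ... | tri≈ _ 0≡x _ = contradiction (sym 0≡x) x≢0
  ... | tri> _ _ x<0 = subst (0# <_) (-x*-x≡x*x x) (*-pos (x<0⇒0<-x x<0) (x<0⇒0<-x x<0))

  0≤x*x : ∀ x → 0# ≤ x * x
  0≤x*x x with x ≟ 0#
  ... | yes refl = inj₂ (sym (zeroˡ 0#))
  ... | no x≢0   = inj₁ (x≢0⇒0<x*x x≢0)

  x*x≡0⇔x≡0 : ∀ {x} → x * x ≡ 0# ⇔ x ≡ 0#
  x*x≡0⇔x≡0 {x} = mk⇔ to (λ { refl → zeroˡ 0# })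
    where
    to : x * x ≡ 0# → x ≡ 0#
    to x*x≡0 with x ≟ 0#
    ... | yes x≡0 = x≡0
    ... | no x≢0  = contradiction (x≢0⇒0<x*x x≢0) (irrefl (sym x*x≡0))

  0≤x+y : ∀ {x y} → 0# ≤ x → 0# ≤ y → 0# ≤ x + y
  0≤x+y {x} {y} (inj₁ 0<x) (inj₁ 0<y) =
    inj₁ (<-trans 0<y (subst (_< x + y) (+-identityˡ y) (+-mono-< y 0<x)))
  0≤x+y {x} (inj₁ 0<x) (inj₂ refl) = inj₁ (subst (0# <_) (sym (+-identityʳ x)) 0<x)
  0≤x+y {y = y} (inj₂ refl) 0≤y = subst (0# ≤_) (sym (+-identityˡ y)) 0≤y

  x+y≡0⇒x≡0 : ∀ {x y} → 0# ≤ x → 0# ≤ y → x + y ≡ 0# → x ≡ 0#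
  x+y≡0⇒x≡0 (inj₂ 0≡x) _ _ = sym 0≡x
  x+y≡0⇒x≡0 {x} {y} (inj₁ 0<x) 0≤y x+y≡0 = contradiction 0≤y ¬0≤y
    where
    y<0 : y < 0#
    y<0 = subst₂ _<_ (+-identityˡ y) x+y≡0 (+-mono-< y 0<x)
    ¬0≤y : ¬ (0# ≤ y)
    ¬0≤y (inj₁ 0<y)  = irrefl refl (<-trans 0<y y<0)
    ¬0≤y (inj₂ refl) = irrefl refl y<0

  0≤sum : ∀ {n} (x : Vector Carrier n) → (∀ i → 0# ≤ x i) → 0# ≤ sum x
  0≤sum {zero}  x 0≤x = inj₂ refl
  0≤sum {suc n} x 0≤x = 0≤x+y (0≤x zero) (0≤sum (x ∘ suc) (0≤x ∘ suc))

  sum≡0⇔ : ∀ {n} (x : Vector Carrier n) → (∀ i → 0# ≤ x i) → sum x ≡ 0# ⇔ (∀ i → x i ≡ 0#)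
  sum≡0⇔ {zero}  x 0≤x = mk⇔ (λ _ ()) (λ _ → refl)
  sum≡0⇔ {suc n} x 0≤x = mk⇔ to from
    where
    0≤tail : 0# ≤ sum (x ∘ suc)
    0≤tail = 0≤sum (x ∘ suc) (0≤x ∘ suc)
    tail≡0⇔ : sum (x ∘ suc) ≡ 0# ⇔ (∀ i → x (suc i) ≡ 0#)
    tail≡0⇔ = sum≡0⇔ (x ∘ suc) (0≤x ∘ suc)
    to : sum x ≡ 0# → ∀ i → x i ≡ 0#
    to sum≡0 zero    = x+y≡0⇒x≡0 (0≤x zero) 0≤tail sum≡0
    to sum≡0 (suc i) =
      Equivalence.to tail≡0⇔ (x+y≡0⇒x≡0 0≤tail (0≤x zero) (trans (+-comm _ _) sum≡0)) i
    from : (∀ i → x i ≡ 0#) → sum x ≡ 0#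
    from x≡0 = trans (cong₂ _+_ (x≡0 zero) (Equivalence.from tail≡0⇔ (x≡0 ∘ suc))) (+-identityˡ 0#)

  ∑x²≡0⇔ : ∀ {n} (x : Vector Carrier n) → ∑[ i < n ] (x i * x i) ≡ 0# ⇔ (∀ i → x i ≡ 0#)
  ∑x²≡0⇔ x = ⇔.trans (sum≡0⇔ _ (λ i → 0≤x*x (x i))) (∀-cong-⇔ λ i → x*x≡0⇔x≡0)

  ∑∑x²≡0⇔ : ∀ {m d} (x : Fin m × Fin d → Carrier) →
            ∑[ i < m ] ∑[ k < d ] (x (i , k) * x (i , k)) ≡ 0# ⇔ (∀ n → x n ≡ 0#)
  ∑∑x²≡0⇔ {d = d} x =
    ⇔.trans (sum≡0⇔ (λ i → ∑[ k < d ] (x (i , k) * x (i , k)))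
                    (λ i → 0≤sum _ (λ k → 0≤x*x (x (i , k)))))
            (⇔.trans (∀-cong-⇔ λ i → ∑x²≡0⇔ (λ k → x (i , k))) ∀-curry-⇔)

  ∑ᴾ : ∀ {n} → Vector (Poly Carrier V) n → Poly Carrier V
  ∑ᴾ = foldr _⊕_ (const 0#)

  eval-∑ᴾ : ∀ {n} (f : Vector (Poly Carrier V) n) (x : V → Carrier) →
            eval ℝ (∑ᴾ f) x ≡ ∑[ i < n ] eval ℝ (f i) x
  eval-∑ᴾ {n = zero}  f x = refl
  eval-∑ᴾ {n = suc n} f x = cong (eval ℝ (f zero) x +_) (eval-∑ᴾ (f ∘ suc) x)

  sumOfSquaresᴾ : ∀ {m d} → (Fin m × Fin d → Poly Carrier V) → Poly Carrier V
  sumOfSquaresᴾ g = ∑ᴾ λ i → ∑ᴾ λ k → g (i , k) ⊗ g (i , k)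

  sumOfSquaresᴾ≡0⇔ : ∀ {m d} (g : Fin m × Fin d → Poly Carrier V) (x : V → Carrier) →
                     eval ℝ (sumOfSquaresᴾ g) x ≡ 0# ⇔ (∀ n → eval ℝ (g n) x ≡ 0#)
  sumOfSquaresᴾ≡0⇔ {m = m} {d} g x =
    ⇔.trans (≡⇒ (cong (_≡ 0#) eval≡∑∑)) (∑∑x²≡0⇔ (λ n → eval ℝ (g n) x))
    where
    eval≡∑∑ : eval ℝ (sumOfSquaresᴾ g) x ≡
              ∑[ i < m ] ∑[ k < d ] (eval ℝ (g (i , k)) x * eval ℝ (g (i , k)) x)
    eval≡∑∑ = trans (eval-∑ᴾ (λ i → ∑ᴾ λ k → g (i , k) ⊗ g (i , k)) x)
                    (sum-cong-≗ λ i → eval-∑ᴾ (λ k → g (i , k) ⊗ g (i , k)) x)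

  eval-[] : (f : Poly Carrier V) {σ : V → Poly Carrier W} {x : W → Carrier} {y : V → Carrier} →
            (∀ v → eval ℝ (σ v) x ≡ y v) → eval ℝ (f [ σ ]) x ≡ eval ℝ f y
  eval-[] (const c) σ≡y = refl
  eval-[] (var v)   σ≡y = σ≡y v
  eval-[] (f ⊕ g)   σ≡y = cong₂ _+_ (eval-[] f σ≡y) (eval-[] g σ≡y)
  eval-[] (f ⊗ g)   σ≡y = cong₂ _*_ (eval-[] f σ≡y) (eval-[] g σ≡y)

  infix 20 _⊖_
  _⊖_ : Poly Carrier V → Poly Carrier V → Poly Carrier V
  f ⊖ g = f ⊕ (const (- 1#) ⊗ g)

  eval-⊖ : (f g : Poly Carrier V) (x : V → Carrier) → eval ℝ (f ⊖ g) x ≡ eval ℝ f x - eval ℝ g x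
  eval-⊖ f g x = cong (eval ℝ f x +_) (-1*x≈-x (eval ℝ g x))

  eval-⊖≡0⇔ : (f g : Poly Carrier V) (x : V → Carrier) →
              eval ℝ (f ⊖ g) x ≡ 0# ⇔ eval ℝ f x ≡ eval ℝ g x
  eval-⊖≡0⇔ f g x = ⇔.trans (≡⇒ (cong (_≡ 0#) (eval-⊖ f g x))) x-y≡0⇔x≡y

  infix 4 _∈span_
  _∈span_ : (U → Carrier) → (U → Carrier) → Set
  s ∈span u = ∃ λ l → ∀ n → s n ≡ l * u n

  ∈span-zero⇔ : {s u : U → Carrier} → (∀ n → u n ≡ 0#) → s ∈span u ⇔ (∀ n → s n ≡ 0#)
  ∈span-zero⇔ {u = u} u≡0 = mk⇔
    (λ (l , s≡lu) n → trans (s≡lu n) (trans (cong (l *_) (u≡0 n)) (zeroʳ l)))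
    (λ s≡0 → 0# , λ n → trans (s≡0 n) (sym (zeroˡ (u n))))

  ∈span⇔cross : {s u : U → Carrier} (j : U) → u j ≢ 0# → s ∈span u ⇔ (∀ n → u j * s n ≡ s j * u n)
  ∈span⇔cross {s = s} {u} j uj≢0 = mk⇔ to from
    where
    uj⁻¹ : Carrier
    uj⁻¹ = (u j ⁻¹) uj≢0
    uj⁻¹*uj≡1 : uj⁻¹ * u j ≡ 1#
    uj⁻¹*uj≡1 = trans (*-comm uj⁻¹ (u j)) (⁻¹-inverse (u j) uj≢0)
    to : s ∈span u → ∀ n → u j * s n ≡ s j * u n
    to (l , s≡lu) n = begin
      u j * s n          ≡⟨ cong (u j *_) (s≡lu n) ⟩
      u j * (l * u n)    ≡⟨ x∙yz≈yx∙z (u j) l (u n) ⟩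
      (l * u j) * u n    ≡⟨ cong (_* u n) (sym (s≡lu j)) ⟩
      s j * u n          ∎
    from : (∀ n → u j * s n ≡ s j * u n) → s ∈span u
    from cross = uj⁻¹ * s j , λ n → begin
      s n                       ≡⟨ sym (*-identityˡ (s n)) ⟩
      1# * s n                  ≡⟨ cong (_* s n) (sym uj⁻¹*uj≡1) ⟩
      (uj⁻¹ * u j) * s n        ≡⟨ *-assoc uj⁻¹ (u j) (s n) ⟩
      uj⁻¹ * (u j * s n)        ≡⟨ cong (uj⁻¹ *_) (cross n) ⟩
      uj⁻¹ * (s j * u n)        ≡⟨ sym (*-assoc uj⁻¹ (s j) (u n)) ⟩
      (uj⁻¹ * s j) * u n        ∎

  zero-or-nonzero-entry : ∀ {m d} (u : Fin m × Fin d → Carrier) →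
                          (∀ n → u n ≡ 0#) ⊎ ∃ λ n → u n ≢ 0#
  zero-or-nonzero-entry {m} {d} u with all? (λ i → all? λ k → u (i , k) ≟ 0#)
  ... | yes u≡0 = inj₁ (Equivalence.to ∀-curry-⇔ u≡0)
  ... | no u≢0 with ¬∀⟶∃¬ m _ (λ i → all? λ k → u (i , k) ≟ 0#) u≢0
  ...   | i , u[i,-]≢0 with ¬∀⟶∃¬ d _ (λ k → u (i , k) ≟ 0#) u[i,-]≢0
  ...     | k , u[i,k]≢0 = inj₂ ((i , k) , u[i,k]≢0)

  span-equations : ∀ {m d} (u : Fin m × Fin d → Carrier) →
                   Σ (Fin m × Fin d → Poly Carrier (Fin m × Fin d)) λ g →
                     ∀ s → s ∈span u ⇔ (∀ n → eval ℝ (g n) s ≡ 0#)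
  span-equations u with zero-or-nonzero-entry u
  ... | inj₁ u≡0 = var , λ s → ∈span-zero⇔ u≡0
  ... | inj₂ (j , uj≢0) = (λ n → (const (u j) ⊗ var n) ⊖ (var j ⊗ const (u n))) , λ s →
    ⇔.trans (∈span⇔cross j uj≢0)
            (∀-cong-⇔ λ n → ⇔.sym (eval-⊖≡0⇔ (const (u j) ⊗ var n) (var j ⊗ const (u n)) s))

  differences : ∀ {m d} → (Fin (suc m) × Fin d → Carrier) → Fin (suc m) × Fin d → Carrier
  differences x (i , k) = x (i , k) - x (zero , k)

  differencesᴾ : ∀ {m d} → Fin (suc m) × Fin d → Poly Carrier (Fin (suc m) × Fin d)
  differencesᴾ (i , k) = var (i , k) ⊖ var (zero , k)

  eval-differencesᴾ : ∀ {m d} (x : Fin (suc m) × Fin d → Carrier) n →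
                      eval ℝ (differencesᴾ n) x ≡ differences x n
  eval-differencesᴾ x (i , k) = eval-⊖ (var (i , k)) (var (zero , k)) x

  ∝⇔differences∈span : ∀ {m d} (p t : Fin (suc m) → Fin d → Carrier) →
                       _∝_ ℝ p t ⇔ differences (uncurry p) ∈span differences (uncurry t)
  ∝⇔differences∈span p t = mk⇔ to from
    where
    to : _∝_ ℝ p t → differences (uncurry p) ∈span differences (uncurry t)
    to (p* , l , p≡p*+lt) = l , λ (i , k) → begin
      p i k - p zero k                              ≡⟨ cong₂ _-_ (p≡p*+lt i k) (p≡p*+lt zero k) ⟩
      (p* k + l * t i k) - (p* k + l * t zero k)    ≡⟨ [x+y]-[x+z]≡y-z (p* k) _ _ ⟩
      l * t i k - l * t zero k                      ≡⟨ sym (x[y-z]≈xy-xz l (t i k) (t zero k)) ⟩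
      l * (t i k - t zero k)                        ∎
    from : differences (uncurry p) ∈span differences (uncurry t) → _∝_ ℝ p t
    from (l , s≡lu) = (λ k → p zero k - l * t zero k) , l , λ i k → begin
      p i k                                    ≡⟨ sym (x+[y-x]≡y (p zero k) (p i k)) ⟩
      p zero k + (p i k - p zero k)            ≡⟨ cong (p zero k +_) (s≡lu (i , k)) ⟩
      p zero k + l * (t i k - t zero k)        ≡⟨ cong (p zero k +_) (x[y-z]≈xy-xz l _ _) ⟩
      p zero k + (l * t i k - l * t zero k)    ≡⟨ x∙yz≈xz∙y (p zero k) _ _ ⟩
      (p zero k - l * t zero k) + l * t i k    ∎

lemma13 : (ℝ : RealField) → (m d : ℕ) → (t : Fin m → Fin d → RealField.Carrier ℝ) →
    Σ (Poly (RealField.Carrier ℝ) (Fin m × Fin d)) λ f →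
    ∀ (p : Fin m → Fin d → RealField.Carrier ℝ) →
    (eval ℝ f (λ { (i , k) → p i k }) ≡ RealField.0# ℝ) ⇔ _∝_ ℝ p t
lemma13 ℝ zero    d t = const 0# , λ p → mk⇔ (λ _ → (λ _ → 0#) , 0# , λ ()) (λ _ → refl)
  where open RealField ℝ using (0#)
lemma13 ℝ (suc m) d t = f , λ p → begin
  eval ℝ f (uncurry p) ≡ 0#
    ∼⟨ sumOfSquaresᴾ≡0⇔ (λ n → g n [ differencesᴾ ]) (uncurry p) ⟩
  (∀ n → eval ℝ (g n [ differencesᴾ ]) (uncurry p) ≡ 0#)
    ∼⟨ ∀-cong-⇔ (λ n → ≡⇒ (cong (_≡ 0#) (eval-[] (g n) (eval-differencesᴾ (uncurry p))))) ⟩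
  (∀ n → eval ℝ (g n) (differences (uncurry p)) ≡ 0#)
    ∼⟨ ⇔.sym (g-spec (differences (uncurry p))) ⟩
  differences (uncurry p) ∈span differences (uncurry t)
    ∼⟨ ⇔.sym (∝⇔differences∈span p t) ⟩
  _∝_ ℝ p t ∎
  where
  open RealField ℝ using (Carrier; 0#)
  open RealFieldProperties ℝ
  open EquationalReasoning {k = equivalence}
  g : Fin (suc m) × Fin d → Poly Carrier (Fin (suc m) × Fin d)
  g = proj₁ (span-equations (differences (uncurry t)))
  g-spec : ∀ s → s ∈span differences (uncurry t) ⇔ (∀ n → eval ℝ (g n) s ≡ 0#)
  g-spec = proj₂ (span-equations (differences (uncurry t)))
  f : Poly Carrier (Fin (suc m) × Fin d)
  f = sumOfSquaresᴾ (λ n → g n [ differencesᴾ ])
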